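{- Let $C=\mathbb{Z}_n$, let $S\subseteq C\setminus\{0\}$, and let $\Gamma=\mathrm{Cay}(C,S)$ be connected and arc-transitive. Let $b>1$ be an integer. Then the following are equivalent: (i) $\Gamma\cong\Sigma[\overline{K}_b]$ for some digraph $\Sigma$; (ii) there exist $g_0\in C$ of order $b$ and a subset $T\subseteq S$ with $S=T+\langle g_0\rangle=\{t+x: t\in T,\ x\in\langle g_0\rangle\}$ and $|S|=|T|\cdot b$.
   Context: $\mathrm{Cay}(C,S)$ is the digraph with vertex set $C$ and an arc $v\to w$ iff $w-v\in S$. Arc-transitive means the automorphism group is transitive on arcs; connected means the underlying undirected graph is connected. $\overline{K}_b$ is the digraph on $b$ vertices with no arcs. For digraphs $\Gamma_1,\Gamma_2$, the lexicographic product $\Gamma_1[\Gamma_2]$ has vertex set $V(\Gamma_1)\times V(\Gamma_2)$, and $(u_1,u_2)\to(v_1,v_2)$ is an arc iff either $u_1\to v_1$ is an arc of $\Gamma_1$, or $u_1=v_1$ and $u_2\to v_2$ is an arc of $\Gamma_2$. -}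

module Defs where

open import Level using (0ℓ)
open import Data.Nat using (ℕ; zero; suc; _+_; _*_; _∸_; _<_; NonZero)
open import Data.Nat.DivMod using (_mod_)
open import Data.Fin using (Fin; toℕ)
open import Data.Fin.Subset using (Subset; _∈_; _∉_)
open import Data.Product using (Σ; ∃; _×_; _,_)
open import Data.Sum using (_⊎_)
open import Data.Empty using (⊥)
open import Relation.Nullary using (¬_)
open import Relation.Binary.PropositionalEquality using (_≡_; _≢_)
open import Relation.Binary.Construct.Closure.ReflexiveTransitive using (Star)
open import Relation.Binary.Construct.Closure.Symmetric using (SymClosure)
open import Function.Bundles using (_⤖_; Bijection)
open import Function.Bundles using (_⇔_)

record Digraph : Set₁ where
  field
    Vertex : Set
    Arc    : Vertex → Vertex → Set
open Digraph public

record _≅_ (Γ₁ Γ₂ : Digraph) : Set where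
  field
    bij      : Vertex Γ₁ ⤖ Vertex Γ₂
    arc-pres : ∀ u v → Arc Γ₁ u v ⇔ Arc Γ₂ (Bijection.to bij u) (Bijection.to bij v)

Automorphism : Digraph → Set
Automorphism Γ = Γ ≅ Γ

ArcTransitive : Digraph → Set
ArcTransitive Γ = ∀ u v u′ v′ → Arc Γ u v → Arc Γ u′ v′ →
  Σ (Automorphism Γ) λ σ →
    (Bijection.to (_≅_.bij σ) u ≡ u′) × (Bijection.to (_≅_.bij σ) v ≡ v′)

Connected : Digraph → Set
Connected Γ = ∀ u v → Star (SymClosure (Arc Γ)) u v

K̄ : ℕ → Digraph
K̄ b = record { Vertex = Fin b ; Arc = λ _ _ → ⊥ }

_[_] : Digraph → Digraph → Digraph
Γ₁ [ Γ₂ ] = record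
  { Vertex = Vertex Γ₁ × Vertex Γ₂
  ; Arc = λ { (u₁ , u₂) (v₁ , v₂) →
        Arc Γ₁ u₁ v₁ ⊎ ((u₁ ≡ v₁) × Arc Γ₂ u₂ v₂) } }

module _ (n : ℕ) .{{_ : NonZero n}} where

  0ₙ : Fin n
  0ₙ = 0 mod n

  _⊕_ : Fin n → Fin n → Fin n
  a ⊕ b = (toℕ a + toℕ b) mod n

  _⊖_ : Fin n → Fin n → Fin n
  w ⊖ v = (toℕ w + (n ∸ toℕ v)) mod n

  _·_ : ℕ → Fin n → Fin n
  k · g = (k * toℕ g) mod n

  HasOrder : Fin n → ℕ → Set
  HasOrder g b = (0 < b) × (b · g ≡ 0ₙ) × (∀ k → 0 < k → k < b → k · g ≢ 0ₙ)

  InSubgroup : Fin n → Fin n → Set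
  InSubgroup g x = ∃ λ k → x ≡ k · g

  Cay : Subset n → Digraph
  Cay S = record { Vertex = Fin n ; Arc = λ v w → (w ⊖ v) ∈ S }

module Submission where

open import Defs
open import Data.Nat using (ℕ; zero; suc; pred; _+_; _*_; _∸_; _<_; _≤_; _<?_; NonZero; z<s; s<s;
  >-nonZero; >-nonZero⁻¹; ≢-nonZero; ≢-nonZero⁻¹)
open import Data.Nat.Properties hiding (_≟_)
open import Data.Nat.DivMod
open import Data.Nat.Divisibility using (_∣_; divides; m%n≡0⇒n∣m; n∣m⇒m%n≡0; *-cancelʳ-∣; ∣⇒≤)
open import Data.Nat.GCD using (gcd; gcd-GCD; module Bézout; gcd[m,n]∣m; gcd[m,n]∣n; gcd[m,n]≢0)
open import Data.Nat.Coprimality using (coprime-/gcd; coprime-divisor)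
open import Data.Nat.Induction using (<-rec)
open import Data.Fin using (Fin; zero; suc; toℕ; fromℕ<; quotRem; combine; _≟_)
open import Data.Fin.Properties using (toℕ-injective; toℕ-fromℕ<; toℕ<n; toℕ-combine; remQuot-combine; combine-remQuot)
open import Data.Fin.Permutation using (Permutation′; permutation; transpose; _⟨$⟩ʳ_; _⟨$⟩ˡ_; inverseˡ; inverseʳ)
open import Data.Fin.Subset using (Subset; _∈_; _∉_; _⊆_; ∣_∣)
open import Data.Vec using ([]; _∷_; lookup; tabulate)
open import Data.Vec.Properties using ([]=⇒lookup; lookup⇒[]=; lookup∘tabulate)
open import Data.Bool using (Bool; true; false; if_then_else_)
open import Data.Bool.Properties using (⇔→≡)
import Data.Bool.Properties as Bool
open import Data.Sum using (inj₁; inj₂)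
open import Data.Product using (Σ; ∃; _×_; _,_; proj₁; proj₂; swap)
open import Function using (_∘_)
open import Function.Bundles using (_⇔_; mk⇔; mk↔ₛ′; _↔_; Inverse; Equivalence)
open import Function.Construct.Composition using (_⇔-∘_)
open import Function.Construct.Symmetry using (⇔-sym)
open import Function.Properties.Bijection using (⤖⇒↔)
open import Function.Properties.Inverse using (↔⇒⤖)
open import Relation.Binary.PropositionalEquality hiding ([_])
open import Relation.Binary.Definitions using (DecidableEquality)
open import Relation.Nullary using (¬_; yes; no; does; contradiction; _×-dec_)
open import Relation.Nullary.Decidable using (does-⇔; dec-true; dec-false)
open import Relation.Unary using (Decidable)
open import Algebra.Properties.CommutativeSemigroup +-commutativeSemigroup using (xy∙z≈xz∙y)
open import Algebra.Properties.Semiring.Sum +-*-semiring using (sum; sum-replicate-zero; sum-cong-≗; ∑-comm; sum-permute)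

-- Let χ : ℕ → Bool be the n-periodic characteristic function of S. Both (i) and
-- (ii) are equivalent to: χ has a period M with b·M = n, i.e. S is a union of cosets
-- of the subgroup of ℤ_n of order b.
--
-- Given such an M, the decomposition x = M·q + r identifies Cay(ℤ_n, S) with a
-- lexicographic product with K̄_b (the arcs only depend on residues mod M), and
-- S = (S ∩ [0, M)) + ⟨M⟩ with |S| = b·|S ∩ [0, M)|.
--
-- Conversely, two vertices in the same block of Σ[K̄_b] have the same
-- out-neighbourhood, so their difference is a period of χ. Hence the periods in
-- ℤ_n, which are the n/p multiples of the least period p, form a union of blocks,
-- so b divides n/p and M = p·(n/p)/b works. From (ii), S + g₀ ⊆ S, so g₀ and then
-- gcd(n, g₀) = n/b are periods.

-- Periods of functions on ℕ

Period : ∀ {a} {A : Set a} → (ℕ → A) → ℕ → Set a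
Period f p = ∀ i → f (i + p) ≡ f i

module _ {a} {A : Set a} {f : ℕ → A} where
  open ≡-Reasoning

  period-0 : Period f 0
  period-0 i = cong f (+-identityʳ i)

  period-+ : ∀ {p q} → Period f p → Period f q → Period f (p + q)
  period-+ {p} {q} per-p per-q i = begin
    f (i + (p + q)) ≡⟨ cong f (+-assoc i p q) ⟨
    f (i + p + q)   ≡⟨ per-q (i + p) ⟩
    f (i + p)       ≡⟨ per-p i ⟩
    f i             ∎

  period-cancelʳ : ∀ {p q} → Period f (p + q) → Period f q → Period f p
  period-cancelʳ {p} {q} per-pq per-q i = begin
    f (i + p)       ≡⟨ per-q (i + p) ⟨
    f (i + p + q)   ≡⟨ cong f (+-assoc i p q) ⟩
    f (i + (p + q)) ≡⟨ per-pq i ⟩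
    f i             ∎

  period-* : ∀ {p} → Period f p → ∀ k → Period f (k * p)
  period-* per-p zero    = period-0
  period-* per-p (suc k) = period-+ per-p (period-* per-p k)

  period-*ʳ : ∀ {p} → Period f p → ∀ k → Period f (p * k)
  period-*ʳ {p} per-p k = subst (Period f) (*-comm k p) (period-* per-p k)

  period-% : ∀ {p q} .{{_ : NonZero p}} → Period f p → Period f q → Period f (q % p)
  period-% {p} {q} per-p per-q =
    period-cancelʳ (subst (Period f) (m≡m%n+[m/n]*n q p) per-q) (period-* per-p (q / p))

  period-gcd : ∀ {p q} → Period f p → Period f q → Period f (gcd p q)
  period-gcd {p} {q} per-p per-q with Bézout.identity (gcd-GCD p q)
  ... | Bézout.+- x y eq = period-cancelʳ (subst (Period f) (sym eq) (period-* per-p x)) (period-* per-q y)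
  ... | Bézout.-+ x y eq = period-cancelʳ (subst (Period f) (sym eq) (period-* per-q y)) (period-* per-p x)

  period-+ˡ : ∀ {p} → Period f p → ∀ k i → f (p * k + i) ≡ f i
  period-+ˡ {p} per-p k i = trans (cong f (+-comm (p * k) i)) (period-*ʳ per-p k i)

  period-reduce : ∀ {n} .{{_ : NonZero n}} → Period f n → ∀ i → f (i % n) ≡ f i
  period-reduce {n} per-n i = sym (trans (cong f (m≡m%n+[m/n]*n i n)) (period-* per-n (i / n) (i % n)))

  period-reduceˡ : ∀ {n} .{{_ : NonZero n}} → Period f n → ∀ i j → f (i % n + j) ≡ f (i + j)
  period-reduceˡ {n} per-n i j = begin
    f (i % n + j)             ≡⟨ period-* per-n (i / n) (i % n + j) ⟨
    f (i % n + j + i / n * n) ≡⟨ cong f (xy∙z≈xz∙y (i % n) j _) ⟩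
    f (i % n + i / n * n + j) ≡⟨ cong (λ k → f (k + j)) (m≡m%n+[m/n]*n i n) ⟨
    f (i + j)                 ∎

  period-∸ : ∀ {p} → Period f p → ∀ {n} k i j → p * k + i ≤ n →
             f (j + (n ∸ (p * k + i))) ≡ f (j + (n ∸ i))
  period-∸ {p} per-p {n} k i j pk+i≤n = begin
    f (j + (n ∸ (p * k + i)))         ≡⟨ period-*ʳ per-p k _ ⟨
    f (j + (n ∸ (p * k + i)) + p * k) ≡⟨ cong f (+-assoc j _ (p * k)) ⟩
    f (j + (n ∸ (p * k + i) + p * k)) ≡⟨ cong (λ m → f (j + m)) n∸[pk+i]+pk≡n∸i ⟩
    f (j + (n ∸ i))                   ∎
    where
    n∸[pk+i]+pk≡n∸i : n ∸ (p * k + i) + p * k ≡ n ∸ i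
    n∸[pk+i]+pk≡n∸i = begin
      n ∸ (p * k + i) + p * k ≡⟨ cong (λ m → n ∸ m + p * k) (+-comm (p * k) i) ⟩
      n ∸ (i + p * k) + p * k ≡⟨ cong (_+ p * k) (∸-+-assoc n i (p * k)) ⟨
      n ∸ i ∸ p * k + p * k   ≡⟨ m∸n+n≡m (m+n≤o⇒m≤o∸n (p * k) pk+i≤n) ⟩
      n ∸ i                   ∎

  period? : DecidableEquality A → ∀ {n} .{{_ : NonZero n}} → Period f n → Decidable (Period f)
  period? _≟_ {n} per-n p with allUpTo? (λ i → f (i + p) ≟ f i) n
  ... | no ¬below = no λ per-p → ¬below λ {i} _ → per-p i
  ... | yes below = yes λ i → begin
        f (i + p)     ≡⟨ period-reduceˡ per-n i p ⟨
        f (i % n + p) ≡⟨ below (m%n<n i n) ⟩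
        f (i % n)     ≡⟨ period-reduce per-n i ⟩
        f i           ∎

module _ {f : ℕ → Bool} {g : ℕ} (closed : ∀ i → f i ≡ true → f (i + g) ≡ true) where

  closed-* : ∀ k i → f i ≡ true → f (i + k * g) ≡ true
  closed-* zero    i fi = subst (λ j → f j ≡ true) (sym (+-identityʳ i)) fi
  closed-* (suc k) i fi = subst (λ j → f j ≡ true) (+-assoc i g (k * g)) (closed-* k (i + g) (closed i fi))

  -- Stepping back by g is stepping forward by (n - 1)·g.
  closed⇒period : ∀ {n} .{{_ : NonZero n}} → Period f n → Period f g
  closed⇒period {n} per-n i = ⇔→≡ (mk⇔ back (closed i))
    where
    back : f (i + g) ≡ true → f i ≡ true
    back fig = begin
      f i                      ≡⟨ period-*ʳ per-n g i ⟨
      f (i + n * g)            ≡⟨ cong (λ m → f (i + m * g)) (suc-pred n) ⟨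
      f (i + suc (pred n) * g) ≡⟨ cong f (+-assoc i g _) ⟨
      f (i + g + pred n * g)   ≡⟨ closed-* (pred n) (i + g) fig ⟩
      true                     ∎
      where open ≡-Reasoning

record IsLeastPeriod {a} {A : Set a} (f : ℕ → A) (p : ℕ) : Set a where
  field
    positive : 0 < p
    period   : Period f p
    least    : ∀ {q} → 0 < q → q < p → ¬ Period f q

module _ {a} {A : Set a} {f : ℕ → A} where

  leastPeriod : Decidable (Period f) → ∀ {n} → 0 < n → Period f n → ∃ (IsLeastPeriod f)
  leastPeriod period? = <-rec _ search _
    where
    positivePeriod? : Decidable (λ q → 0 < q × Period f q)
    positivePeriod? q = (0 <? q) ×-dec period? q
    search : ∀ n → (∀ {m} → m < n → 0 < m → Period f m → ∃ (IsLeastPeriod f)) →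
             0 < n → Period f n → ∃ (IsLeastPeriod f)
    search n smaller 0<n per-n with anyUpTo? positivePeriod? n
    ... | yes (m , m<n , 0<m , per-m) = smaller m<n 0<m per-m
    ... | no ¬smaller = n , record
      { positive = 0<n ; period = per-n ; least = λ 0<q q<n per-q → ¬smaller (_ , q<n , 0<q , per-q) }

  leastPeriod∣period : ∀ {p q} → IsLeastPeriod f p → Period f q → p ∣ q
  leastPeriod∣period {p} {q} least-p per-q = m%n≡0⇒n∣m q p q%p≡0
    where
    open IsLeastPeriod least-p
    instance
      p≢0 : NonZero p
      p≢0 = >-nonZero positive
    q%p≡0 : q % p ≡ 0
    q%p≡0 with q % p in eq
    ... | zero  = refl
    ... | suc r = contradiction (subst (Period f) eq (period-% period per-q))
                                (least z<s (subst (_< p) eq (m%n<n q p)))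

𝟙 : Bool → ℕ
𝟙 true  = 1
𝟙 false = 0

∑< : ℕ → (ℕ → ℕ) → ℕ
∑< k h = sum {k} (λ i → h (toℕ i))

∑<-+ : ∀ m n (h : ℕ → ℕ) → ∑< (m + n) h ≡ ∑< m h + ∑< n (λ i → h (m + i))
∑<-+ zero    n h = refl
∑<-+ (suc m) n h = trans (cong (h 0 +_) (∑<-+ m n (h ∘ suc))) (sym (+-assoc (h 0) _ _))

∑<-cong : ∀ k {h h′ : ℕ → ℕ} → (∀ {i} → i < k → h i ≡ h′ i) → ∑< k h ≡ ∑< k h′
∑<-cong zero    eq = refl
∑<-cong (suc k) eq = cong₂ _+_ (eq z<s) (∑<-cong k (eq ∘ s<s))

∑<-zero : ∀ k {h : ℕ → ℕ} → (∀ {i} → i < k → h i ≡ 0) → ∑< k h ≡ 0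
∑<-zero k eq = trans (∑<-cong k eq) (sum-replicate-zero k)

∑<-periodic : ∀ {h : ℕ → ℕ} {p} → Period h p → ∀ k → ∑< (k * p) h ≡ k * ∑< p h
∑<-periodic         per-h zero    = refl
∑<-periodic {h} {p} per-h (suc k) = begin
  ∑< (p + k * p) h                      ≡⟨ ∑<-+ p (k * p) h ⟩
  ∑< p h + ∑< (k * p) (λ i → h (p + i)) ≡⟨ cong (∑< p h +_) (∑<-cong (k * p) λ {i} _ → shift i) ⟩
  ∑< p h + ∑< (k * p) h                 ≡⟨ cong (∑< p h +_) (∑<-periodic per-h k) ⟩
  ∑< p h + k * ∑< p h                   ∎
  where
  open ≡-Reasoning
  shift : ∀ i → h (p + i) ≡ h i
  shift i = trans (cong h (+-comm p i)) (per-h i)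

module _ {a} {A : Set a} {f : ℕ → A} (period? : Decidable (Period f)) {p} (least-p : IsLeastPeriod f p) where
  open IsLeastPeriod least-p

  isPeriod : ℕ → ℕ
  isPeriod i = 𝟙 (does (period? i))

  ∑<-isPeriod : ∀ k → ∑< (k * p) isPeriod ≡ k
  ∑<-isPeriod k = trans (∑<-periodic isPeriod-periodic k) (trans (cong (k *_) (one-below positive least)) (*-identityʳ k))
    where
    isPeriod-periodic : Period isPeriod p
    isPeriod-periodic i = cong 𝟙 (does-⇔ (mk⇔ (λ per → period-cancelʳ per period) (λ per → period-+ per period))
                                         (period? (i + p)) (period? i))
    one-below : ∀ {q} → 0 < q → (∀ {j} → 0 < j → j < q → ¬ Period f j) → ∑< q isPeriod ≡ 1
    one-below {suc q} _ no-smaller = cong₂ _+_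
      (cong 𝟙 (dec-true (period? 0) period-0))
      (∑<-zero q λ i<q → cong 𝟙 (dec-false (period? _) (no-smaller z<s (s<s i<q))))

sum-const : ∀ k c → sum {k} (λ _ → c) ≡ k * c
sum-const zero    c = refl
sum-const (suc k) c = cong (c +_) (sum-const k c)

sum-if-≟ : ∀ {m} (k : Fin m) c → sum (λ i → if does (k ≟ i) then c else 0) ≡ c
sum-if-≟ {suc m} zero    c = trans (cong (c +_) (sum-replicate-zero m)) (+-identityʳ c)
sum-if-≟         (suc k) c = sum-if-≟ k c

module _ {X V : Set} {b : ℕ} (φ : X ↔ (V × Fin b)) where

  block : X → V
  block = proj₁ ∘ Inverse.to φ

  layer : X → Fin b
  layer = proj₂ ∘ Inverse.to φ

module _ {n b : ℕ} {V : Set} (φ : Fin n ↔ (V × Fin b)) where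
  open Inverse φ using (to; from; strictlyInverseˡ; strictlyInverseʳ)

  relayer : Permutation′ b → Permutation′ n
  relayer τ = permutation (move (τ ⟨$⟩ʳ_)) (move (τ ⟨$⟩ˡ_))
                          (undo (τ ⟨$⟩ʳ_) (τ ⟨$⟩ˡ_) (inverseʳ τ))
                          (undo (τ ⟨$⟩ˡ_) (τ ⟨$⟩ʳ_) (inverseˡ τ))
    where
    move : (Fin b → Fin b) → Fin n → Fin n
    move h x = from (block φ x , h (layer φ x))
    undo : ∀ h h′ → (∀ {k} → h (h′ k) ≡ k) → ∀ x → move h (move h′ x) ≡ x
    undo h h′ hh′ x = begin
      from (block φ (move h′ x) , h (layer φ (move h′ x)))
        ≡⟨ cong (λ (v , k) → from (v , h k)) (strictlyInverseˡ _) ⟩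
      from (block φ x , h (h′ (layer φ x)))
        ≡⟨ cong (λ k → from (block φ x , k)) hh′ ⟩
      from (to x)
        ≡⟨ strictlyInverseʳ x ⟩
      x ∎
      where open ≡-Reasoning

  block-relayer : ∀ τ x → block φ (relayer τ ⟨$⟩ʳ x) ≡ block φ x
  block-relayer τ x = cong proj₁ (strictlyInverseˡ _)

  layer-relayer : ∀ τ x → layer φ (relayer τ ⟨$⟩ʳ x) ≡ τ ⟨$⟩ʳ layer φ x
  layer-relayer τ x = cong proj₂ (strictlyInverseˡ _)

  layerSum : (Fin n → ℕ) → Fin b → ℕ
  layerSum f i = sum (λ x → if does (layer φ x ≟ i) then f x else 0)

  sum≡∑layerSum : ∀ f → sum f ≡ sum (layerSum f)
  sum≡∑layerSum f = begin
    sum f                        ≡⟨ sum-cong-≗ (λ x → sum-if-≟ (layer φ x) (f x)) ⟨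
    sum (λ x → sum (restrict x)) ≡⟨ ∑-comm restrict ⟩
    sum (layerSum f)             ∎
    where
    open ≡-Reasoning
    restrict : Fin n → Fin b → ℕ
    restrict x i = if does (layer φ x ≟ i) then f x else 0

module _ {n b : ℕ} {V : Set} (φ : Fin n ↔ (V × Fin (suc b))) (f : Fin n → ℕ)
         (f-blockwise : ∀ x y → block φ x ≡ block φ y → f x ≡ f y) where

  -- Swapping layers 0 and i, blockwise, is a permutation of Fin n that fixes f.
  layerSum-constant : ∀ i → layerSum φ f i ≡ layerSum φ f zero
  layerSum-constant i = trans (sum-permute _ (relayer φ τ)) (sum-cong-≗ relabel)
    where
    τ = transpose zero i
    lands-on-i⇔zero : ∀ k → τ ⟨$⟩ʳ k ≡ i ⇔ k ≡ zero
    lands-on-i⇔zero k = mk⇔ (λ τk≡i → trans (sym (inverseˡ τ)) (trans (cong (τ ⟨$⟩ˡ_) τk≡i) (inverseˡ τ)))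
                            (cong (τ ⟨$⟩ʳ_))
    relabel : ∀ x → (if does (layer φ (relayer φ τ ⟨$⟩ʳ x) ≟ i) then f (relayer φ τ ⟨$⟩ʳ x) else 0)
                  ≡ (if does (layer φ x ≟ zero) then f x else 0)
    relabel x = cong₂ (λ c y → if c then y else 0)
      (trans (cong (λ k → does (k ≟ i)) (layer-relayer φ τ x))
             (does-⇔ (lands-on-i⇔zero (layer φ x)) (τ ⟨$⟩ʳ layer φ x ≟ i) (layer φ x ≟ zero)))
      (f-blockwise _ x (block-relayer φ τ x))

  ∣-sum-blockwise : suc b ∣ sum f
  ∣-sum-blockwise = divides (layerSum φ f zero) (begin
    sum f                                 ≡⟨ sum≡∑layerSum φ f ⟩
    sum (layerSum φ f)                    ≡⟨ sum-cong-≗ layerSum-constant ⟩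
    sum {suc b} (λ _ → layerSum φ f zero) ≡⟨ sum-const (suc b) _ ⟩
    suc b * layerSum φ f zero             ≡⟨ *-comm (suc b) _ ⟩
    layerSum φ f zero * suc b             ∎)
    where open ≡-Reasoning

·≡0ₙ⇔∣ : ∀ {n} .{{_ : NonZero n}} k (g : Fin n) → _·_ n k g ≡ 0ₙ n ⇔ n ∣ k * toℕ g
·≡0ₙ⇔∣ {n} k g = mk⇔
  (λ k·g≡0 → m%n≡0⇒n∣m _ n (trans (sym (toℕ-fromℕ< _)) (trans (cong toℕ k·g≡0) toℕ-0ₙ)))
  (λ n∣kg → toℕ-injective (trans (toℕ-fromℕ< _) (trans (n∣m⇒m%n≡0 _ n n∣kg) (sym toℕ-0ₙ))))
  where
  toℕ-0ₙ : toℕ (0ₙ n) ≡ 0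
  toℕ-0ₙ = trans (toℕ-fromℕ< _) (m<n⇒m%n≡m (>-nonZero⁻¹ n))

gcd-nonZero : ∀ n g .{{_ : NonZero n}} → NonZero (gcd n g)
gcd-nonZero n g = ≢-nonZero (gcd[m,n]≢0 n g (inj₁ (≢-nonZero⁻¹ n)))

module _ (n g : ℕ) .{{_ : NonZero n}} where
  private
    instance
      d≢0 : NonZero (gcd n g)
      d≢0 = gcd-nonZero n g
    d = gcd n g
    g/d*d≡g : g / d * d ≡ g
    g/d*d≡g = m/n*n≡m (gcd[m,n]∣n n g)

  n/gcd*gcd≡n : n / gcd n g * gcd n g ≡ n
  n/gcd*gcd≡n = m/n*n≡m (gcd[m,n]∣m n g)

  n/gcd∣ : ∀ {k} → n ∣ k * g → n / gcd n g ∣ k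
  n/gcd∣ {k} n∣kg = coprime-divisor (coprime-/gcd n g)
    (subst (n / d ∣_) (*-comm k (g / d)) (*-cancelʳ-∣ d (subst₂ _∣_ (sym n/gcd*gcd≡n) kg≡k*g/d*d n∣kg)))
    where
    kg≡k*g/d*d : k * g ≡ k * (g / d) * d
    kg≡k*g/d*d = trans (cong (k *_) (sym g/d*d≡g)) (sym (*-assoc k (g / d) d))

  n∣n/gcd*g : n ∣ n / gcd n g * g
  n∣n/gcd*g = divides (g / d) (begin
    n / d * g             ≡⟨ cong (n / d *_) (trans (sym g/d*d≡g) (*-comm (g / d) d)) ⟩
    n / d * (d * (g / d)) ≡⟨ *-assoc (n / d) d (g / d) ⟨
    n / d * d * (g / d)   ≡⟨ cong (_* (g / d)) n/gcd*gcd≡n ⟩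
    n * (g / d)           ≡⟨ *-comm n (g / d) ⟩
    g / d * n             ∎)
    where open ≡-Reasoning

-- n / gcd(n, g) is the least k with k·g ≡ 0, so it equals the order b.
hasOrder⇒b*gcd≡n : ∀ {n b} .{{_ : NonZero n}} {g : Fin n} → HasOrder n g b → b * gcd n (toℕ g) ≡ n
hasOrder⇒b*gcd≡n {n} {b} {g} (0<b , b·g≡0 , minimal) =
  trans (cong (_* gcd n (toℕ g)) (sym N≡b)) (n/gcd*gcd≡n n (toℕ g))
  where
  instance
    d≢0 : NonZero (gcd n (toℕ g))
    d≢0 = gcd-nonZero n (toℕ g)
  N = n / gcd n (toℕ g)
  N∣b : N ∣ b
  N∣b = n/gcd∣ n (toℕ g) (Equivalence.to (·≡0ₙ⇔∣ b g) b·g≡0)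
  N·g≡0 : _·_ n N g ≡ 0ₙ n
  N·g≡0 = Equivalence.from (·≡0ₙ⇔∣ N g) (n∣n/gcd*g n (toℕ g))
  0<N : 0 < N
  0<N with N in eq
  ... | zero  = contradiction (trans (sym (n/gcd*gcd≡n n (toℕ g))) (cong (_* gcd n (toℕ g)) eq)) (≢-nonZero⁻¹ n)
  ... | suc _ = z<s
  N≡b : N ≡ b
  N≡b = ≤-antisym (∣⇒≤ {{>-nonZero 0<b}} N∣b) (≮⇒≥ λ N<b → minimal N 0<N N<b N·g≡0)

-- Subsets of ℤ_n as periodic functions on ℕ

module _ {n} .{{_ : NonZero n}} where
  open ≡-Reasoning

  mod-cong : ∀ {a c} → a % n ≡ c % n → a mod n ≡ c mod n
  mod-cong eq = toℕ-injective (trans (toℕ-fromℕ< _) (trans eq (sym (toℕ-fromℕ< _))))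

  toℕ-mod : ∀ a → toℕ (a mod n) ≡ a % n
  toℕ-mod a = toℕ-fromℕ< _

  mod-toℕ : (x : Fin n) → toℕ x mod n ≡ x
  mod-toℕ x = toℕ-injective (trans (toℕ-fromℕ< _) (m<n⇒m%n≡m (toℕ<n x)))

  %-absorbʳ : ∀ a c → (a + c % n) % n ≡ (a + c) % n
  %-absorbʳ a c = begin
    (a + c % n) % n         ≡⟨ %-distribˡ-+ a (c % n) n ⟩
    (a % n + c % n % n) % n ≡⟨ cong (λ m → (a % n + m) % n) (m%n%n≡m%n c n) ⟩
    (a % n + c % n) % n     ≡⟨ %-distribˡ-+ a c n ⟨
    (a + c) % n             ∎

  %-absorbˡ : ∀ a c → (a % n + c) % n ≡ (a + c) % n
  %-absorbˡ a c = begin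
    (a % n + c) % n ≡⟨ cong (_% n) (+-comm (a % n) c) ⟩
    (c + a % n) % n ≡⟨ %-absorbʳ c a ⟩
    (c + a) % n     ≡⟨ cong (_% n) (+-comm c a) ⟩
    (a + c) % n     ∎

  -- The arc v → w of Cay(ℤ_n, S) is present iff χ S (toℕ w + (n ∸ toℕ v)) is true,
  -- and the periods of χ S are the translations of ℤ_n that fix S.
  χ : Subset n → ℕ → Bool
  χ S i = lookup S (i mod n)

  module _ (S : Subset n) where

    ∈⇔χ : ∀ i → (i mod n) ∈ S ⇔ χ S i ≡ true
    ∈⇔χ i = mk⇔ []=⇒lookup (lookup⇒[]= _ S)

    χ-toℕ : ∀ x → χ S (toℕ x) ≡ lookup S x
    χ-toℕ x = cong (lookup S) (mod-toℕ x)

    χ-+% : ∀ i j → χ S (i + j % n) ≡ χ S (i + j)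
    χ-+% i j = cong (lookup S) (mod-cong (%-absorbʳ i j))

    χ-period-n : Period (χ S) n
    χ-period-n i = cong (lookup S) (mod-cong ([m+n]%n≡m%n i n))

    χ-period? : Decidable (Period (χ S))
    χ-period? = period? Bool._≟_ χ-period-n

    χ-leastPeriod : ∃ (IsLeastPeriod (χ S))
    χ-leastPeriod = leastPeriod χ-period? (>-nonZero⁻¹ n) χ-period-n

-- S is a union of cosets of the subgroup ⟨M⟩ of ℤ_n, which has order b.
CosetUnion : ∀ {n} .{{_ : NonZero n}} → Subset n → ℕ → Set
CosetUnion {n} S b = ∃ λ M → b * M ≡ n × Period (χ S) M

CosetDecomposition : ∀ {n} .{{_ : NonZero n}} → Subset n → ℕ → Set
CosetDecomposition {n} S b =
  Σ (Fin n) λ g₀ → HasOrder n g₀ b × Σ (Subset n) λ T → T ⊆ S ×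
    (∀ s → (s ∈ S) ⇔ (Σ (Fin n) λ t → t ∈ T × Σ (Fin n) λ x → InSubgroup n g₀ x × s ≡ _⊕_ n t x))
    × ∣ S ∣ ≡ ∣ T ∣ * b

-- A union of cosets is a lexicographic product

toℕ-quotRem : ∀ {b} M (x : Fin (b * M)) →
              toℕ x ≡ M * toℕ (proj₂ (quotRem {b} M x)) + toℕ (proj₁ (quotRem {b} M x))
toℕ-quotRem {b} M x = trans (cong toℕ (sym (combine-remQuot {b} M x))) (toℕ-combine {b} {M} _ _)

-- Cay(ℤ_n, S) on the residues modulo M; it is Cay(ℤ_M, S mod M) when M is a period of S.
Quotient : ∀ {n} .{{_ : NonZero n}} → Subset n → ℕ → Digraph
Quotient {n} S M = record { Vertex = Fin M ; Arc = λ a c → χ S (toℕ c + (n ∸ toℕ a)) ≡ true }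

module _ {b M} .{{_ : NonZero (b * M)}} (S : Subset (b * M)) (per-M : Period (χ S) M) where
  private
    rem : Fin (b * M) → Fin M
    rem = proj₁ ∘ quotRem {b} M

  χ-difference-rem : ∀ u v → χ S (toℕ v + (b * M ∸ toℕ u)) ≡ χ S (toℕ (rem v) + (b * M ∸ toℕ (rem u)))
  χ-difference-rem u v = begin
    χ S (toℕ v + (b * M ∸ toℕ u))
      ≡⟨ cong₂ (λ i j → χ S (i + (b * M ∸ j))) (toℕ-quotRem {b} M v) (toℕ-quotRem {b} M u) ⟩
    χ S (M * qv + toℕ (rem v) + (b * M ∸ (M * qu + toℕ (rem u))))
      ≡⟨ cong (χ S) (+-assoc (M * qv) _ _) ⟩
    χ S (M * qv + (toℕ (rem v) + (b * M ∸ (M * qu + toℕ (rem u)))))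
      ≡⟨ period-+ˡ per-M qv _ ⟩
    χ S (toℕ (rem v) + (b * M ∸ (M * qu + toℕ (rem u))))
      ≡⟨ period-∸ per-M qu _ _ (subst (_≤ b * M) (toℕ-quotRem {b} M u) (<⇒≤ (toℕ<n u))) ⟩
    χ S (toℕ (rem v) + (b * M ∸ toℕ (rem u)))
      ∎
    where
    open ≡-Reasoning
    qu = toℕ (proj₂ (quotRem {b} M u))
    qv = toℕ (proj₂ (quotRem {b} M v))

  periodic⇒lex : Cay (b * M) S ≅ (Quotient S M [ K̄ b ])
  periodic⇒lex = record
    { bij      = ↔⇒⤖ (mk↔ₛ′ (quotRem {b} M) (λ (r , q) → combine q r)
                            (λ (r , q) → cong swap (remQuot-combine q r)) (combine-remQuot {b} M))
    ; arc-pres = λ u v → mk⇔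
        (λ uv → inj₁ (trans (sym (χ-difference-rem u v)) (Equivalence.to (∈⇔χ S _) uv)))
        λ { (inj₁ a) → Equivalence.from (∈⇔χ S _) (trans (χ-difference-rem u v) a) ; (inj₂ (_ , ())) }
    }

cosetUnion⇒lex : ∀ {n b} .{{_ : NonZero n}} (S : Subset n) → CosetUnion S b →
                 Σ Digraph λ Σ′ → Cay n S ≅ (Σ′ [ K̄ b ])
cosetUnion⇒lex S (M , refl , per-M) = Quotient S M , periodic⇒lex S per-M

-- A lexicographic product is a union of cosets

module _ {Γ Σ′ : Digraph} {b} (iso : Γ ≅ (Σ′ [ K̄ b ])) where

  lex↔ : Vertex Γ ↔ (Vertex Σ′ × Fin b)
  lex↔ = ⤖⇒↔ (_≅_.bij iso)

  sameBlock⇒sameOut : ∀ {u v} → block lex↔ u ≡ block lex↔ v → ∀ w → Arc Γ u w ⇔ Arc Γ v w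
  sameBlock⇒sameOut {u} {v} eq w = mk⇔ (⊆out eq) (⊆out (sym eq))
    where
    ⊆out : ∀ {u v} → block lex↔ u ≡ block lex↔ v → Arc Γ u w → Arc Γ v w
    ⊆out {u} {v} eq uw with Equivalence.to (_≅_.arc-pres iso u w) uw
    ... | inj₁ a = Equivalence.from (_≅_.arc-pres iso v w) (inj₁ (subst (λ z → Arc Σ′ z (block lex↔ w)) eq a))

module _ {n} .{{_ : NonZero n}} (S : Subset n) {u v : Fin n}
         (sameOut : ∀ w → Arc (Cay n S) u w ⇔ Arc (Cay n S) v w) where
  open ≡-Reasoning

  χ-sameShift : ∀ i → χ S (i + (n ∸ toℕ u)) ≡ χ S (i + (n ∸ toℕ v))
  χ-sameShift i = begin
    χ S (i + (n ∸ toℕ u))             ≡⟨ period-reduceˡ (χ-period-n S) i _ ⟨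
    χ S (i % n + (n ∸ toℕ u))         ≡⟨ cong (λ j → χ S (j + (n ∸ toℕ u))) (toℕ-mod i) ⟨
    χ S (toℕ (i mod n) + (n ∸ toℕ u)) ≡⟨ ⇔→≡ (∈⇔χ S _ ⇔-∘ (sameOut (i mod n) ⇔-∘ ⇔-sym (∈⇔χ S _))) ⟩
    χ S (toℕ (i mod n) + (n ∸ toℕ v)) ≡⟨ cong (λ j → χ S (j + (n ∸ toℕ v))) (toℕ-mod i) ⟩
    χ S (i % n + (n ∸ toℕ v))         ≡⟨ period-reduceˡ (χ-period-n S) i _ ⟩
    χ S (i + (n ∸ toℕ v))             ∎

  sameOut⇒period : Period (χ S) (toℕ v + (n ∸ toℕ u))
  sameOut⇒period i = begin
    χ S (i + (toℕ v + (n ∸ toℕ u))) ≡⟨ cong (χ S) (+-assoc i (toℕ v) _) ⟨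
    χ S (i + toℕ v + (n ∸ toℕ u))   ≡⟨ χ-sameShift (i + toℕ v) ⟩
    χ S (i + toℕ v + (n ∸ toℕ v))   ≡⟨ cong (χ S) (+-assoc i (toℕ v) _) ⟩
    χ S (i + (toℕ v + (n ∸ toℕ v))) ≡⟨ cong (λ j → χ S (i + j)) (m+[n∸m]≡n (<⇒≤ (toℕ<n v))) ⟩
    χ S (i + n)                     ≡⟨ χ-period-n S i ⟩
    χ S i                           ∎

  sameOut⇒period-transfer : Period (χ S) (toℕ u) → Period (χ S) (toℕ v)
  sameOut⇒period-transfer per-u =
    period-cancelʳ (subst (Period (χ S)) v-u+u≡v+n (period-+ sameOut⇒period per-u)) (χ-period-n S)
    where
    v-u+u≡v+n : toℕ v + (n ∸ toℕ u) + toℕ u ≡ toℕ v + n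
    v-u+u≡v+n = trans (+-assoc (toℕ v) _ _) (cong (toℕ v +_) (m∸n+n≡m (<⇒≤ (toℕ<n u))))

module _ {n b} {Σ′ : Digraph} .{{_ : NonZero n}} (S : Subset n) (iso : Cay n S ≅ (Σ′ [ K̄ (suc b) ])) where
  private
    p = proj₁ (χ-leastPeriod S)
    least-p = proj₂ (χ-leastPeriod S)

    isPeriod-at : Fin n → ℕ
    isPeriod-at x = isPeriod (χ-period? S) least-p (toℕ x)

    isPeriod-blockwise : ∀ x y → block (lex↔ iso) x ≡ block (lex↔ iso) y → isPeriod-at x ≡ isPeriod-at y
    isPeriod-blockwise x y eq = cong 𝟙 (does-⇔
      (mk⇔ (sameOut⇒period-transfer S (sameBlock⇒sameOut iso eq))
           (sameOut⇒period-transfer S (sameBlock⇒sameOut iso (sym eq))))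
      (χ-period? S (toℕ x)) (χ-period? S (toℕ y)))

    open _∣_ (leastPeriod∣period least-p (χ-period-n S)) renaming (quotient to q; equality to n≡q*p)
    open _∣_ (∣-sum-blockwise (lex↔ iso) isPeriod-at isPeriod-blockwise) renaming (quotient to c; equality to ∑≡c*b)

    -- q = n / p counts the periods in [0, n), and they come in whole blocks.
    q≡c*b : q ≡ c * suc b
    q≡c*b = begin
      q                                           ≡⟨ ∑<-isPeriod (χ-period? S) least-p q ⟨
      ∑< (q * p) (isPeriod (χ-period? S) least-p) ≡⟨ cong (λ m → ∑< m (isPeriod (χ-period? S) least-p)) n≡q*p ⟨
      ∑< n (isPeriod (χ-period? S) least-p)       ≡⟨ ∑≡c*b ⟩
      c * suc b                                   ∎
      where open ≡-Reasoning

  lex⇒cosetUnion : CosetUnion S (suc b)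
  lex⇒cosetUnion = c * p , b*[c*p]≡n , period-* (IsLeastPeriod.period least-p) c
    where
    open ≡-Reasoning
    b*[c*p]≡n : suc b * (c * p) ≡ n
    b*[c*p]≡n = begin
      suc b * (c * p) ≡⟨ *-assoc (suc b) c p ⟨
      suc b * c * p   ≡⟨ cong (_* p) (*-comm (suc b) c) ⟩
      c * suc b * p   ≡⟨ cong (_* p) q≡c*b ⟨
      q * p           ≡⟨ n≡q*p ⟨
      n               ∎

-- A union of cosets is a coset decomposition

∣∣≡sum : ∀ {n} (p : Subset n) → ∣ p ∣ ≡ sum (𝟙 ∘ lookup p)
∣∣≡sum []          = refl
∣∣≡sum (true ∷ p)  = cong suc (∣∣≡sum p)
∣∣≡sum (false ∷ p) = ∣∣≡sum p

_↾_ : ∀ {n} → Subset n → ℕ → Subset n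
S ↾ M = tabulate λ x → if does (toℕ x <? M) then lookup S x else false

module _ {n} .{{_ : NonZero n}} (S : Subset n) where

  ↾⊆ : ∀ M → S ↾ M ⊆ S
  ↾⊆ M {x} x∈S↾M =
    lookup⇒[]= x S (kept (does (toℕ x <? M)) (trans (sym (lookup∘tabulate _ x)) ([]=⇒lookup x∈S↾M)))
    where
    kept : ∀ c → (if c then lookup S x else false) ≡ true → lookup S x ≡ true
    kept true eq = eq

  ∣∣≡∑<χ : ∣ S ∣ ≡ ∑< n (𝟙 ∘ χ S)
  ∣∣≡∑<χ = trans (∣∣≡sum S) (sum-cong-≗ λ x → cong 𝟙 (sym (χ-toℕ S x)))

  ∣↾∣≡∑<χ : ∀ M → ∣ S ↾ M ∣ ≡ ∑< n (λ i → 𝟙 (if does (i <? M) then χ S i else false))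
  ∣↾∣≡∑<χ M = trans (∣∣≡sum (S ↾ M)) (sum-cong-≗ λ x →
    cong 𝟙 (trans (lookup∘tabulate _ x) (cong (if does (toℕ x <? M) then_else false) (sym (χ-toℕ S x)))))

module _ {b M} .{{_ : NonZero (b * M)}} (1<b : 1 < b) where
  private
    n = b * M
    instance
      M≢0 : NonZero M
      M≢0 = m*n≢0⇒n≢0 b

  M<n : M < n
  M<n = subst (M <_) (*-comm M b) (m<m*n M b 1<b)

  Mₙ : Fin n
  Mₙ = fromℕ< M<n

  toℕ-·Mₙ : ∀ k → toℕ (_·_ n k Mₙ) ≡ k * M % n
  toℕ-·Mₙ k = trans (toℕ-mod _) (cong (λ m → k * m % n) (toℕ-fromℕ< M<n))

  Mₙ-hasOrder : HasOrder n Mₙ b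
  Mₙ-hasOrder = <-trans z<s 1<b , Equivalence.from (·≡0ₙ⇔∣ b Mₙ) n∣b*Mₙ , k·Mₙ≢0
    where
    n∣b*Mₙ : n ∣ b * toℕ Mₙ
    n∣b*Mₙ = divides 1 (trans (cong (b *_) (toℕ-fromℕ< M<n)) (sym (*-identityˡ n)))
    k·Mₙ≢0 : ∀ k → 0 < k → k < b → _·_ n k Mₙ ≢ 0ₙ n
    k·Mₙ≢0 k 0<k k<b k·Mₙ≡0 = ≢-nonZero⁻¹ (k * M) {{m*n≢0 k M {{>-nonZero 0<k}}}} (begin
      k * M             ≡⟨ m<n⇒m%n≡m (*-monoˡ-< M k<b) ⟨
      k * M % n         ≡⟨ toℕ-·Mₙ k ⟨
      toℕ (_·_ n k Mₙ)  ≡⟨ cong toℕ k·Mₙ≡0 ⟩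
      toℕ (0ₙ n)        ≡⟨ toℕ-mod 0 ⟩
      0 % n             ≡⟨ m<n⇒m%n≡m (>-nonZero⁻¹ n) ⟩
      0                 ∎)
      where open ≡-Reasoning

  module _ (S : Subset n) (per-M : Period (χ S) M) where

    S≡[S↾M]+⟨Mₙ⟩ : ∀ s → (s ∈ S) ⇔
      (Σ (Fin n) λ t → t ∈ S ↾ M × Σ (Fin n) λ x → InSubgroup n Mₙ x × s ≡ _⊕_ n t x)
    S≡[S↾M]+⟨Mₙ⟩ s = mk⇔ split join
      where
      open ≡-Reasoning
      r = toℕ s % M
      q = toℕ s / M
      t : Fin n
      t = fromℕ< (<-trans (m%n<n (toℕ s) M) M<n)
      toℕ-t : toℕ t ≡ r
      toℕ-t = toℕ-fromℕ< _
      t<M : toℕ t < M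
      t<M = subst (_< M) (sym toℕ-t) (m%n<n (toℕ s) M)
      q*M<n : q * M < n
      q*M<n = ≤-<-trans (m/n*n≤m (toℕ s) M) (toℕ<n s)
      split : s ∈ S → _
      split s∈S = t , t∈S↾M , _·_ n q Mₙ , (q , refl) , sym t⊕q·Mₙ≡s
        where
        t∈S↾M : t ∈ S ↾ M
        t∈S↾M = lookup⇒[]= t (S ↾ M) (begin
          lookup (S ↾ M) t                                  ≡⟨ lookup∘tabulate _ t ⟩
          (if does (toℕ t <? M) then lookup S t else false) ≡⟨ cong (if_then lookup S t else false)
                                                                  (dec-true (toℕ t <? M) t<M) ⟩
          lookup S t                                        ≡⟨ χ-toℕ S t ⟨
          χ S (toℕ t)                                       ≡⟨ cong (χ S) toℕ-t ⟩
          χ S r                                             ≡⟨ period-reduce per-M (toℕ s) ⟩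
          χ S (toℕ s)                                       ≡⟨ χ-toℕ S s ⟩
          lookup S s                                        ≡⟨ []=⇒lookup s∈S ⟩
          true                                              ∎)
        t⊕q·Mₙ≡s : _⊕_ n t (_·_ n q Mₙ) ≡ s
        t⊕q·Mₙ≡s = begin
          (toℕ t + toℕ (_·_ n q Mₙ)) mod n ≡⟨ cong₂ (λ i j → (i + j) mod n) toℕ-t (toℕ-·Mₙ q) ⟩
          (r + q * M % n) mod n            ≡⟨ cong (λ j → (r + j) mod n) (m<n⇒m%n≡m q*M<n) ⟩
          (r + q * M) mod n                ≡⟨ cong (_mod n) (m≡m%n+[m/n]*n (toℕ s) M) ⟨
          toℕ s mod n                      ≡⟨ mod-toℕ s ⟩
          s                                ∎
      join : _ → s ∈ S
      join (t , t∈S↾M , x , (k , x≡k·Mₙ) , s≡t⊕x) = lookup⇒[]= s S (begin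
        lookup S s              ≡⟨ cong (lookup S) s≡t⊕x ⟩
        χ S (toℕ t + toℕ x)     ≡⟨ cong (λ j → χ S (toℕ t + j)) (trans (cong toℕ x≡k·Mₙ) (toℕ-·Mₙ k)) ⟩
        χ S (toℕ t + k * M % n) ≡⟨ χ-+% S (toℕ t) (k * M) ⟩
        χ S (toℕ t + k * M)     ≡⟨ period-* per-M k (toℕ t) ⟩
        χ S (toℕ t)             ≡⟨ χ-toℕ S t ⟩
        lookup S t              ≡⟨ []=⇒lookup (↾⊆ S M t∈S↾M) ⟩
        true                    ∎)

    ∣S∣≡∣S↾M∣*b : ∣ S ∣ ≡ ∣ S ↾ M ∣ * b
    ∣S∣≡∣S↾M∣*b = begin
      ∣ S ∣                ≡⟨ ∣∣≡∑<χ S ⟩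
      ∑< (b * M) (𝟙 ∘ χ S) ≡⟨ ∑<-periodic (cong 𝟙 ∘ per-M) b ⟩
      b * ∑< M (𝟙 ∘ χ S)   ≡⟨ *-comm b _ ⟩
      ∑< M (𝟙 ∘ χ S) * b   ≡⟨ cong (_* b) ∑<M≡∣S↾M∣ ⟩
      ∣ S ↾ M ∣ * b        ∎
      where
      open ≡-Reasoning
      b≢0 : NonZero b
      b≢0 = >-nonZero (<-trans z<s 1<b)
      below : ℕ → ℕ
      below i = 𝟙 (if does (i <? M) then χ S i else false)
      ∑<M≡∣S↾M∣ : ∑< M (𝟙 ∘ χ S) ≡ ∣ S ↾ M ∣
      ∑<M≡∣S↾M∣ = sym (begin
        ∣ S ↾ M ∣                                     ≡⟨ ∣↾∣≡∑<χ S M ⟩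
        ∑< (b * M) below                              ≡⟨ cong (λ c → ∑< (c * M) below) (suc-pred b {{b≢0}}) ⟨
        ∑< (M + pred b * M) below                     ≡⟨ ∑<-+ M (pred b * M) below ⟩
        ∑< M below + ∑< (pred b * M) (below ∘ (M +_)) ≡⟨ cong₂ _+_
          (∑<-cong M {below} λ {i} i<M → cong (λ c → 𝟙 (if c then χ S i else false)) (dec-true (i <? M) i<M))
          (∑<-zero (pred b * M) {below ∘ (M +_)} λ {i} _ →
             cong (λ c → 𝟙 (if c then χ S (M + i) else false)) (dec-false (M + i <? M) (m+n≮m M i))) ⟩
        ∑< M (𝟙 ∘ χ S) + 0                            ≡⟨ +-identityʳ _ ⟩
        ∑< M (𝟙 ∘ χ S)                                ∎)

cosetUnion⇒decomposition : ∀ {n b} .{{_ : NonZero n}} (S : Subset n) → 1 < b →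
                           CosetUnion S b → CosetDecomposition S b
cosetUnion⇒decomposition S 1<b (M , refl , per-M) =
  Mₙ 1<b , Mₙ-hasOrder 1<b , S ↾ M , (λ {x} → ↾⊆ S M {x}) ,
  S≡[S↾M]+⟨Mₙ⟩ 1<b S per-M , ∣S∣≡∣S↾M∣*b 1<b S per-M

-- A coset decomposition is a union of cosets

module _ {n} .{{_ : NonZero n}} (S T : Subset n) (g₀ : Fin n)
         (S≡T+⟨g₀⟩ : ∀ s → (s ∈ S) ⇔
           (Σ (Fin n) λ t → t ∈ T × Σ (Fin n) λ x → InSubgroup n g₀ x × s ≡ _⊕_ n t x)) where

  χ-closed-+g₀ : ∀ i → χ S i ≡ true → χ S (i + toℕ g₀) ≡ true
  χ-closed-+g₀ i χi with Equivalence.to (S≡T+⟨g₀⟩ (i mod n)) (Equivalence.from (∈⇔χ S i) χi)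
  ... | t , t∈T , x , (k , x≡k·g₀) , i≡t⊕x = Equivalence.to (∈⇔χ S (i + g))
          (Equivalence.from (S≡T+⟨g₀⟩ _) (t , t∈T , _·_ n (suc k) g₀ , (suc k , refl) , mod-cong shifted))
    where
    open ≡-Reasoning
    g = toℕ g₀
    i%n≡ : i % n ≡ (toℕ t + k * g % n) % n
    i%n≡ = begin
      i % n                   ≡⟨ toℕ-mod i ⟨
      toℕ (i mod n)           ≡⟨ cong toℕ i≡t⊕x ⟩
      toℕ (_⊕_ n t x)         ≡⟨ toℕ-mod _ ⟩
      (toℕ t + toℕ x) % n     ≡⟨ cong (λ m → (toℕ t + m) % n) (trans (cong toℕ x≡k·g₀) (toℕ-mod _)) ⟩
      (toℕ t + k * g % n) % n ∎
    shifted : (i + g) % n ≡ (toℕ t + toℕ (_·_ n (suc k) g₀)) % n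
    shifted = begin
      (i + g) % n                          ≡⟨ %-absorbˡ i g ⟨
      (i % n + g) % n                      ≡⟨ cong (λ m → (m + g) % n) i%n≡ ⟩
      ((toℕ t + k * g % n) % n + g) % n    ≡⟨ %-absorbˡ _ g ⟩
      (toℕ t + k * g % n + g) % n          ≡⟨ cong (_% n) (+-assoc (toℕ t) _ g) ⟩
      (toℕ t + (k * g % n + g)) % n        ≡⟨ %-absorbʳ (toℕ t) _ ⟨
      (toℕ t + (k * g % n + g) % n) % n    ≡⟨ cong (λ m → (toℕ t + m) % n) (%-absorbˡ (k * g) g) ⟩
      (toℕ t + (k * g + g) % n) % n        ≡⟨ cong (λ m → (toℕ t + m % n) % n) (+-comm (k * g) g) ⟩
      (toℕ t + suc k * g % n) % n          ≡⟨ cong (λ m → (toℕ t + m) % n) (toℕ-mod _) ⟨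
      (toℕ t + toℕ (_·_ n (suc k) g₀)) % n ∎

  decomposition⇒period : Period (χ S) (gcd n (toℕ g₀))
  decomposition⇒period = period-gcd (χ-period-n S) (closed⇒period χ-closed-+g₀ (χ-period-n S))

decomposition⇒cosetUnion : ∀ {n b} .{{_ : NonZero n}} (S : Subset n) → CosetDecomposition S b → CosetUnion S b
decomposition⇒cosetUnion {n} S (g₀ , g₀-order , T , _ , S≡T+⟨g₀⟩ , _) =
  gcd n (toℕ g₀) , hasOrder⇒b*gcd≡n g₀-order , decomposition⇒period S T g₀ S≡T+⟨g₀⟩

lemma2p5 : (n : ℕ) .{{_ : NonZero n}} (S : Subset n) →
    0ₙ n ∉ S →
    Connected (Cay n S) → ArcTransitive (Cay n S) →
    (b : ℕ) → 1 < b →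
    ((Σ Digraph λ Σ′ → Cay n S ≅ (Σ′ [ K̄ b ]))
      ⇔
     (Σ (Fin n) λ g₀ → HasOrder n g₀ b × Σ (Subset n) λ T → T ⊆ S ×
        (∀ s → (s ∈ S) ⇔ (Σ (Fin n) λ t → t ∈ T × Σ (Fin n) λ x → InSubgroup n g₀ x × s ≡ _⊕_ n t x))
        × ∣ S ∣ ≡ ∣ T ∣ * b))
lemma2p5 n S _ _ _ (suc _) 1<b = mk⇔
  (λ (_ , iso) → cosetUnion⇒decomposition S 1<b (lex⇒cosetUnion S iso))
  (cosetUnion⇒lex S ∘ decomposition⇒cosetUnion S)
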